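{- Let $n>1$ be odd, $A=U(n)$, and $\ell=2^{\Omega(n)}-1$. Let $S$ be a sequence in $\mathbb{Z}_n$ and $q$ a prime divisor of $n$. Suppose $T$ is a subsequence of consecutive terms of $S$ of length at least $(\ell+1)/2$ such that every term of $T$ is divisible by $q$. Then $S$ has an $A$-weighted zero-sum subsequence of consecutive terms.
   Context: $\mathbb{Z}_n=\mathbb{Z}/n\mathbb{Z}$, $U(n)$ its group of units. $\Omega(n)$ is the number of prime factors of $n$ counted with multiplicity. A sequence $(x_1,\ldots,x_k)$ ($k\ge1$) in $\mathbb{Z}_n$ is an $A$-weighted zero-sum sequence if there exist $a_1,\ldots,a_k\in A$ with $a_1x_1+\cdots+a_kx_k=0$. A subsequence of consecutive terms is a nonempty block $(x_i,\ldots,x_j)$. An element of $\mathbb{Z}_n$ is divisible by a prime $q\mid n$ if its integer representatives are multiples of $q$. -}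

module Defs where

open import Data.Nat using (ℕ; zero; suc; _+_; _*_; _≤_)
open import Data.Nat.Divisibility using (_∣_)
open import Data.Nat.Primality using (Prime)
open import Data.Nat.Coprimality using (Coprime)
open import Data.Fin using (Fin; toℕ)
open import Data.List using (List; []; _∷_; _++_; length; zipWith)
open import Data.Nat.ListAction using (sum)
open import Data.List.Relation.Unary.All using (All)
open import Data.Product using (Σ; ∃; _×_)
open import Relation.Binary.PropositionalEquality using (_≡_)

-- Ω n ≡ k, given relationally: n is a product of k primes (with multiplicity).
data HasΩ : ℕ → ℕ → Set where
  one   : HasΩ 1 0
  prime : ∀ {p m k} → Prime p → HasΩ m k → HasΩ (p * m) (suc k)

-- Elements of ℤ_n are represented by Fin n (canonical representatives 0..n-1).
-- U(n): residues coprime to n.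
IsUnit : (n : ℕ) → Fin n → Set
IsUnit n a = Coprime (toℕ a) n

wsum : ∀ {n} → List (Fin n) → List (Fin n) → ℕ
wsum as xs = sum (zipWith (λ a x → toℕ a * toℕ x) as xs)

UnitWeightedZeroSum : (n : ℕ) → List (Fin n) → Set
UnitWeightedZeroSum n xs =
  1 ≤ length xs ×
  Σ (List (Fin n)) λ as →
    length as ≡ length xs × All (IsUnit n) as × n ∣ wsum as xs

ConsecutiveSub : ∀ {A : Set} → List A → List A → Set
ConsecutiveSub {A} T S =
  1 ≤ length T × Σ (List A) λ pre → Σ (List A) λ post → S ≡ pre ++ (T ++ post)

DivBy : ∀ {n} → ℕ → Fin n → Set
DivBy q x = q ∣ toℕ x

{-# OPTIONS --safe #-}
-- A sequence of length at least 2^Ω(m), m odd, has a block of consecutive terms that is a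
-- U(m)-weighted zero-sum. Cut off two halves of length 2^(Ω(m)-1). If a prime p ∣ m divides every
-- term of one half, divide that half by p, recurse with m / p, and lift the weights from U(m/p)
-- to U(m). Otherwise every prime factor of m leaves a term prime to it in each half, and the
-- two halves together are a zero-sum: the weights are built one prime factor p at a time,
-- correcting two of them by multiples of the previous modulus, which has room since p ≥ 3.
-- The theorem is the first case applied to T and q.
module Submission where

open import Defs
open import Data.Nat using (ℕ; zero; suc; _+_; _*_; _∸_; _^_; _≤_; _<_; s≤s; z≤n; NonZero; >-nonZero)
open import Data.Nat.Base using (nonTrivial⇒≢1)
open import Data.Nat.Properties
open import Algebra.Properties.CommutativeSemigroup *-commutativeSemigroup using (x∙yz≈y∙xz)
open import Data.Nat.Divisibility
open import Data.Nat.DivMod using (_/_; _%_; _mod_; m%n<n; m≡m%n+[m/n]*n; m*[n/m]≡n)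
open import Data.Nat.Coprimality using (Coprime; coprime-divisor; coprime-Bézout)
open import Data.Nat.GCD using (module Bézout)
open import Data.Nat.Primality
  using (Prime; euclidsLemma; prime⇒irreducible; irreducible[2]; prime⇒nonZero; prime⇒nonTrivial)
open import Data.Nat.ListAction using (sum)
open import Data.Nat.Tactic.RingSolver using (solve-∀)
open import Data.Fin using (Fin; toℕ)
open import Data.Fin.Properties using (toℕ-fromℕ<)
open import Data.List using (List; []; _∷_; _++_; length; replicate; map; zipWith)
open import Data.List.Properties using (++-assoc; length-++; length-map; length-replicate; length-++-≤ˡ)
open import Data.List.Relation.Unary.All as All using (All; []; _∷_)
open import Data.List.Relation.Unary.All.Properties using (++⁺; ++⁻; ++⁻ˡ; ++⁻ʳ; replicate⁺; map⁺)
open import Data.List.Relation.Unary.All.Properties.Core using (¬All⇒Any¬)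
open import Data.List.Relation.Unary.Any using (Any)
open import Data.List.Membership.Propositional using (find)
open import Data.List.Membership.Propositional.Properties using (∈-∃++)
open import Data.List.Relation.Binary.Pointwise using (Pointwise; []; _∷_; Pointwise-length)
open import Data.Product using (Σ; ∃₂; ∃-syntax; _×_; _,_; proj₁)
open import Data.Sum using (_⊎_; inj₁; inj₂)
open import Data.Unit using (⊤; tt)
open import Data.Empty using (⊥-elim)
open import Relation.Nullary using (¬_; yes; no)
open import Relation.Binary.PropositionalEquality

private variable
  A : Set
  a b c d j m p t u w x y : ℕ

prime≢1 : Prime p → p ≢ 1
prime≢1 p-prime = nonTrivial⇒≢1 {{prime⇒nonTrivial p-prime}}

prime∤⇒coprime : Prime p → ¬ p ∣ a → Coprime a p
prime∤⇒coprime p-prime p∤a (d∣a , d∣p) with prime⇒irreducible p-prime d∣p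
... | inj₁ d≡1 = d≡1
... | inj₂ refl = ⊥-elim (p∤a d∣a)

prime∤* : Prime p → ¬ p ∣ a → ¬ p ∣ b → ¬ p ∣ a * b
prime∤* {a = a} {b} p-prime p∤a p∤b p∣ab with euclidsLemma a b p-prime p∣ab
... | inj₁ p∣a = p∤a p∣a
... | inj₂ p∣b = p∤b p∣b

odd-∣ : ¬ 2 ∣ b → a ∣ b → ¬ 2 ∣ a
odd-∣ b-odd a∣b 2∣a = b-odd (∣-trans 2∣a a∣b)

odd-prime∤2 : Prime p → ¬ 2 ∣ p → ¬ p ∣ 2
odd-prime∤2 p-prime p-odd p∣2 with irreducible[2] p∣2
... | inj₁ p≡1 = prime≢1 p-prime p≡1
... | inj₂ refl = p-odd ∣-refl

∣+*⇒∣ : ∀ t → d ∣ m → d ∣ a + m * t → d ∣ a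
∣+*⇒∣ {d} {m} {a} t d∣m d∣a+mt =
  ∣m+n∣m⇒∣n (subst (d ∣_) (+-comm a (m * t)) d∣a+mt) (∣m⇒∣m*n t d∣m)

∣⇒∣+* : ∀ t → d ∣ m → d ∣ a → d ∣ a + m * t
∣⇒∣+* t d∣m d∣a = ∣m∣n⇒∣m+n d∣a (∣m⇒∣m*n t d∣m)

coprime-1 : Coprime a 1
coprime-1 (_ , d∣1) = ∣1⇒≡1 d∣1

coprime-∣ʳ : Coprime a b → c ∣ b → Coprime a c
coprime-∣ʳ a⊥b c∣b (d∣a , d∣c) = a⊥b (d∣a , ∣-trans d∣c c∣b)

coprime-*ʳ : Coprime a b → Coprime a c → Coprime a (b * c)
coprime-*ʳ a⊥b a⊥c (d∣a , d∣bc) =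
  a⊥c (d∣a , coprime-divisor (λ (e∣d , e∣b) → a⊥b (∣-trans e∣d d∣a , e∣b)) d∣bc)

coprime-shift : ∀ t → Coprime a m → Coprime (a + m * t) m
coprime-shift t a⊥m (d∣a+mt , d∣m) = a⊥m (∣+*⇒∣ t d∣m d∣a+mt , d∣m)

coprime-unshift : ∀ t → Coprime (a + m * t) m → Coprime a m
coprime-unshift t a+mt⊥m (d∣a , d∣m) = a+mt⊥m (∣⇒∣+* t d∣m d∣a , d∣m)

coprime-*⇒∤ : Prime p → Coprime a (p * m) → ¬ p ∣ a
coprime-*⇒∤ {m = m} p-prime a⊥pm p∣a = prime≢1 p-prime (a⊥pm (p∣a , m∣m*n m))

coprime-shift-* : Prime p → ¬ p ∣ a + m * t → Coprime a m → Coprime (a + m * t) (p * m)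
coprime-shift-* {t = t} p-prime p∤ a⊥m = coprime-*ʳ (prime∤⇒coprime p-prime p∤) (coprime-shift t a⊥m)

-- From a Bézout identity v x = 1 + w p take u = (p - 1) v.
minus-inverse : Prime p → ¬ p ∣ x → ∃[ u ] p ∣ 1 + u * x
minus-inverse p-prime p∤x with coprime-Bézout (prime∤⇒coprime p-prime p∤x)
... | Bézout.-+ u v 1+ux≡vp = u , divides v 1+ux≡vp
minus-inverse {suc p₁} {x} p-prime p∤x | Bézout.+- v w 1+wp≡vx =
  p₁ * v , divides (1 + p₁ * w) (begin
    1 + p₁ * v * x            ≡⟨ cong (1 +_) (*-assoc p₁ v x) ⟩
    1 + p₁ * (v * x)          ≡⟨ cong (λ e → 1 + p₁ * e) (sym 1+wp≡vx) ⟩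
    1 + p₁ * (1 + w * suc p₁) ≡⟨ identity p₁ w ⟩
    (1 + p₁ * w) * suc p₁     ∎)
  where
  open ≡-Reasoning
  identity : ∀ p₁ w → 1 + p₁ * (1 + w * suc p₁) ≡ (1 + p₁ * w) * suc p₁
  identity = solve-∀

solve-linear : Prime p → ¬ p ∣ x → ∀ s → ∃[ t ] p ∣ s + t * x
solve-linear {p} {x} p-prime p∤x s with minus-inverse p-prime p∤x
... | u , p∣1+ux = s * u , subst (p ∣_) (identity s u x) (∣n⇒∣m*n s p∣1+ux)
  where
  identity : ∀ s u x → s * (1 + u * x) ≡ s + s * u * x
  identity = solve-∀

shift-∤ : d ∣ c + u * m → ¬ d ∣ j * m → ¬ d ∣ c + m * (j + u)
shift-∤ {d} {c} {u} {m} {j} d∣c+um d∤jm d∣ =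
  d∤jm (∣m+n∣m⇒∣n (subst (d ∣_) (identity c m j u) d∣) d∣c+um)
  where
  identity : ∀ c m j u → c + m * (j + u) ≡ (c + u * m) + j * m
  identity = solve-∀

∣-two-solutions : ∀ {s t₁ t₂ t'} →
  d ∣ s + t' * y + t₁ * x → d ∣ s + suc t' * y + t₂ * x →
  d ∣ b + m * t₁ → d ∣ b + m * t₂ → d ∣ m * y
∣-two-solutions {d} {y} {x} {b} {m} {s} {t₁} {t₂} {t'} d∣₁ d∣₂ d∣b₁ d∣b₂ =
  ∣m+n∣m⇒∣n
    (subst (d ∣_) (identity m s t' y t₂ x b t₁)
      (∣m∣n⇒∣m+n (∣n⇒∣m*n m d∣₂) (∣n⇒∣m*n x d∣b₁)))
    (∣m∣n⇒∣m+n (∣n⇒∣m*n m d∣₁) (∣n⇒∣m*n x d∣b₂))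
  where
  identity : ∀ m s t' y t₂ x b t₁ →
    m * (s + suc t' * y + t₂ * x) + x * (b + m * t₁) ≡
    (m * (s + t' * y + t₁ * x) + x * (b + m * t₂)) + m * y
  identity = solve-∀

-- If p ∤ m, let p ∣ c + u m. Then c + m t' stays prime to p for t' = u + 1 and t' = u + 2
-- (as p is odd), and by ∣-two-solutions the two matching values of t cannot both make p ∣ b + m t.
adjust-two : Prime p → ¬ p ∣ 2 → ¬ p ∣ x → ¬ p ∣ y → ¬ p ∣ b → ¬ p ∣ c → ∀ m s →
  ∃₂ λ t t' → ¬ p ∣ b + m * t × ¬ p ∣ c + m * t' × p ∣ s + t' * y + t * x
adjust-two {p} {x} {y} {b} {c} p-prime p∤2 p∤x p∤y p∤b p∤c m s with p ∣? m
... | yes p∣m =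
  let t , p∣s+tx = solve-linear p-prime p∤x s in
  t , 0 , (λ p∣ → p∤b (∣+*⇒∣ t p∣m p∣)) , (λ p∣ → p∤c (∣+*⇒∣ 0 p∣m p∣)) ,
  subst (λ e → p ∣ e + t * x) (sym (+-identityʳ s)) p∣s+tx
... | no p∤m
  with solve-linear p-prime p∤m c
... | u , p∣c+um
  with solve-linear p-prime p∤x (s + suc u * y) | solve-linear p-prime p∤x (s + suc (suc u) * y)
... | t₁ , p∣₁ | t₂ , p∣₂
  with p ∣? b + m * t₁ | p ∣? b + m * t₂
... | no p∤b₁ | _ = t₁ , suc u , p∤b₁ , shift-∤ {c = c} {u} {m} {1} p∣c+um p∤1m , p∣₁
  where
  p∤1m : ¬ p ∣ 1 * m
  p∤1m = subst (λ e → ¬ p ∣ e) (sym (*-identityˡ m)) p∤m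
... | yes _ | no p∤b₂ = t₂ , suc (suc u) , p∤b₂ , shift-∤ {c = c} {u} {m} {2} p∣c+um (prime∤* p-prime p∤2 p∤m) , p∣₂
... | yes p∣b₁ | yes p∣b₂ = ⊥-elim (prime∤* p-prime p∤m p∤y (∣-two-solutions {y = y} {x} {b} {m} {s} {t₁} {t₂} {suc u} p∣₁ p∣₂ p∣b₁ p∣b₂))

weightedSum : List ℕ → (A → ℕ) → List A → ℕ
weightedSum ws f ys = sum (zipWith (λ w y → w * f y) ws ys)

record Weighting (u d : ℕ) (f : A → ℕ) (ys : List A) : Set where
  constructor weighting
  field
    weights        : List ℕ
    length-weights : length weights ≡ length ys
    units          : All (λ w → Coprime w u) weights
    ∣weightedSum   : d ∣ weightedSum weights f ys

ZeroSum : ℕ → (A → ℕ) → List A → Set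
ZeroSum m = Weighting m m

zeroSum-1 : (f : A → ℕ) (ys : List A) → ZeroSum 1 f ys
zeroSum-1 f ys =
  weighting (replicate (length ys) 1) (length-replicate (length ys)) (replicate⁺ _ coprime-1) (1∣ _)

weightedSum-++ : ∀ ws₁ ws₂ (f : A → ℕ) ys₁ ys₂ → length ws₁ ≡ length ys₁ →
  weightedSum (ws₁ ++ ws₂) f (ys₁ ++ ys₂) ≡ weightedSum ws₁ f ys₁ + weightedSum ws₂ f ys₂
weightedSum-++ []       ws₂ f []       ys₂ _   = refl
weightedSum-++ (w ∷ ws) ws₂ f (y ∷ ys) ys₂ len =
  trans (cong (w * f y +_) (weightedSum-++ ws ws₂ f ys ys₂ (suc-injective len)))
        (sym (+-assoc (w * f y) _ _))

weightedSum-/ : .{{_ : NonZero p}} → ∀ ws (f : A → ℕ) ys → All (λ a → p ∣ f a) ys →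
  weightedSum ws f ys ≡ p * weightedSum ws (λ a → f a / p) ys
weightedSum-/ {p} []       f _        _             = sym (*-zeroʳ p)
weightedSum-/ {p} (w ∷ ws) f []       _             = sym (*-zeroʳ p)
weightedSum-/ {p} (w ∷ ws) f (y ∷ ys) (p∣fy ∷ p∣ys) = begin
  w * f y + weightedSum ws f ys
    ≡⟨ cong₂ (λ e r → w * e + r) (sym (m*[n/m]≡n p∣fy)) (weightedSum-/ ws f ys p∣ys) ⟩
  w * (p * (f y / p)) + p * weightedSum ws g ys
    ≡⟨ identity w p (f y / p) (weightedSum ws g ys) ⟩
  p * (w * (f y / p) + weightedSum ws g ys) ∎
  where
  open ≡-Reasoning
  g = λ a → f a / p
  identity : ∀ w p e r → w * (p * e) + p * r ≡ p * (w * e + r)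
  identity = solve-∀

Shifted : ℕ → List ℕ → List ℕ → Set
Shifted m = Pointwise (λ w' w → ∃[ t ] w' ≡ w + m * t)

weightedSum-shifted : ∀ {ws' ws} → Shifted m ws' ws → (f : A → ℕ) (ys : List A) →
  ∃[ e ] weightedSum ws' f ys ≡ weightedSum ws f ys + m * e
weightedSum-shifted {m} [] f ys = 0 , sym (*-zeroʳ m)
weightedSum-shifted {m} (_ ∷ _) f [] = 0 , sym (*-zeroʳ m)
weightedSum-shifted {m} {ws = w ∷ ws} ((t , refl) ∷ shifted) f (y ∷ ys)
  with weightedSum-shifted {m} shifted f ys
... | e , eq = t * f y + e ,
  trans (cong ((w + m * t) * f y +_) eq) (identity w m t (f y) (weightedSum ws f ys) e)
  where
  identity : ∀ w m t a r e → (w + m * t) * a + (r + m * e) ≡ w * a + r + m * (t * a + e)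
  identity = solve-∀

liftWeight : Prime p → Coprime a m → ∃[ t ] Coprime (a + m * t) (p * m)
liftWeight {p} {a} {m} p-prime a⊥m =
  let t , p∤ = avoid in t , coprime-shift-* p-prime p∤ a⊥m
  where
  avoid : ∃[ t ] ¬ p ∣ a + m * t
  avoid with p ∣? m | p ∣? a
  ... | yes p∣m | _ = 0 , λ p∣ → prime≢1 p-prime (a⊥m (∣+*⇒∣ 0 p∣m p∣ , p∣m))
  ... | no p∤m | yes p∣a = 1 , λ p∣ → p∤m (subst (p ∣_) (*-identityʳ m) (∣m+n∣m⇒∣n p∣ p∣a))
  ... | no _   | no p∤a  = 0 , λ p∣ → p∤a (subst (p ∣_) (trans (cong (a +_) (*-zeroʳ m)) (+-identityʳ a)) p∣)

liftUnits : Prime p → ∀ {ws} → All (λ w → Coprime w m) ws →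
  ∃[ ws' ] Shifted m ws' ws × All (λ w → Coprime w (p * m)) ws'
liftUnits p-prime [] = [] , [] , []
liftUnits p-prime (w⊥m ∷ units) with liftWeight p-prime w⊥m | liftUnits p-prime units
... | t , w'⊥pm | ws' , shifted , units' = _ ∷ ws' , (t , refl) ∷ shifted , w'⊥pm ∷ units'

liftZeroSum : Prime p → {f : A → ℕ} {ys : List A} → ZeroSum m f ys → Weighting (p * m) m f ys
liftZeroSum {m = m} p-prime {f} {ys} (weighting ws len units m∣) with liftUnits p-prime units
... | ws' , shifted , units' with weightedSum-shifted {m} shifted f ys
... | e , eq =
  weighting ws' (trans (Pointwise-length shifted) len) units'
    (subst (m ∣_) (sym eq) (∣m∣n⇒∣m+n m∣ (m∣m*n e)))

DividesAll : ℕ → (A → ℕ) → List A → Set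
DividesAll p f = All (λ a → p ∣ f a)

zeroSum-/ : .{{_ : NonZero p}} → Prime p → {f : A → ℕ} {ys : List A} →
  DividesAll p f ys → ZeroSum m (λ a → f a / p) ys → ZeroSum (p * m) f ys
zeroSum-/ {p} {m = m} p-prime {f} {ys} p∣ys zs with liftZeroSum p-prime zs
... | weighting ws len units m∣ =
  weighting ws len units
    (subst (p * m ∣_) (sym (weightedSum-/ ws f ys p∣ys)) (*-monoʳ-∣ p m∣))

data TwoNondivisible (p : ℕ) (f : A → ℕ) : List A → Set where
  twoNondivisible : ∀ P {y} Q {y'} R → ¬ p ∣ f y → ¬ p ∣ f y' →
    TwoNondivisible p f (P ++ y ∷ Q ++ y' ∷ R)

splitAlong : ∀ (P : List A) {y} ys (ws : List ℕ) → length ws ≡ length (P ++ y ∷ ys) →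
  ∃₂ λ bP b → ∃[ bs ] ws ≡ bP ++ b ∷ bs × length bP ≡ length P × length bs ≡ length ys
splitAlong []      ys []       ()
splitAlong []      ys (b ∷ bs) len = [] , b , bs , refl , refl , suc-injective len
splitAlong (_ ∷ P) ys []       ()
splitAlong (_ ∷ P) {y} ys (w ∷ ws) len with splitAlong P {y} ys ws (suc-injective len)
... | bP , b , bs , refl , lenP , lenBs = w ∷ bP , b , bs , refl , cong suc lenP , lenBs

length-++-∷ : ∀ (xs : List A) {a b ys ys'} → length ys ≡ length ys' →
  length (xs ++ a ∷ ys) ≡ length (xs ++ b ∷ ys')
length-++-∷ []       eq = cong suc eq
length-++-∷ (_ ∷ xs) eq = cong suc (length-++-∷ xs eq)

weightedSum-shift₂ : ∀ (f : A → ℕ) bP P bQ Q bR R {b b' y y'} e e' →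
  length bP ≡ length P → length bQ ≡ length Q →
  weightedSum (bP ++ (b + e) ∷ bQ ++ (b' + e') ∷ bR) f (P ++ y ∷ Q ++ y' ∷ R) ≡
  weightedSum (bP ++ b ∷ bQ ++ b' ∷ bR) f (P ++ y ∷ Q ++ y' ∷ R) + (e * f y + e' * f y')
weightedSum-shift₂ f bP P bQ Q bR R {b} {b'} {y} {y'} e e' lenP lenQ
  rewrite weightedSum-++ bP ((b + e) ∷ bQ ++ (b' + e') ∷ bR) f P (y ∷ Q ++ y' ∷ R) lenP
        | weightedSum-++ bP (b ∷ bQ ++ b' ∷ bR) f P (y ∷ Q ++ y' ∷ R) lenP
        | weightedSum-++ bQ ((b' + e') ∷ bR) f Q (y' ∷ R) lenQ
        | weightedSum-++ bQ (b' ∷ bR) f Q (y' ∷ R) lenQ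
  = identity (weightedSum bP f P) b e (f y) (weightedSum bQ f Q) b' e' (f y') (weightedSum bR f R)
  where
  identity : ∀ sP b e a sQ b' e' a' sR →
    sP + ((b + e) * a + (sQ + ((b' + e') * a' + sR))) ≡
    sP + (b * a + (sQ + (b' * a' + sR))) + (e * a + e' * a')
  identity = solve-∀

-- Lift a zero-sum modulo m to one modulo p m: first make every weight prime to p m, then move
-- the two weights at the terms prime to p by multiples of m (adjust-two) to kill the sum mod p.
zeroSum-step : Prime p → ¬ p ∣ 2 → {f : A → ℕ} {ys : List A} →
  TwoNondivisible p f ys → ZeroSum m f ys → ZeroSum (p * m) f ys
zeroSum-step {p} {m = m} p-prime p∤2 {f} (twoNondivisible P {y} Q {y'} R p∤fy p∤fy') zs
  with liftZeroSum p-prime zs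
... | weighting ws len units (divides s sum≡sm)
  with splitAlong P (Q ++ y' ∷ R) ws len
... | bP , b , bs , refl , lenP , lenBs
  with splitAlong Q R bs lenBs
... | bQ , b' , bR , refl , lenQ , lenR
  with ++⁻ bP units
... | unitsP , b⊥pm ∷ unitsRest
  with ++⁻ bQ unitsRest
... | unitsQ , b'⊥pm ∷ unitsR
  with adjust-two p-prime p∤2 p∤fy p∤fy' (coprime-*⇒∤ p-prime b⊥pm) (coprime-*⇒∤ p-prime b'⊥pm) m s
... | t , t' , p∤b+mt , p∤b'+mt' , p∣ =
  weighting new-weights
    (trans (length-++-∷ bP (length-++-∷ bQ refl)) len)
    (++⁺ unitsP (unit p∤b+mt b⊥pm ∷ ++⁺ unitsQ (unit p∤b'+mt' b'⊥pm ∷ unitsR)))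
    (subst (_∣ weightedSum new-weights f (P ++ y ∷ Q ++ y' ∷ R)) (*-comm m p)
      (subst (m * p ∣_) (sym new-sum) (*-monoʳ-∣ m p∣)))
  where
  new-weights = bP ++ (b + m * t) ∷ bQ ++ (b' + m * t') ∷ bR
  unit : ∀ {a e} → ¬ p ∣ a + m * e → Coprime a (p * m) → Coprime (a + m * e) (p * m)
  unit p∤ a⊥pm = coprime-shift-* p-prime p∤ (coprime-∣ʳ a⊥pm (n∣m*n p))
  new-sum : weightedSum new-weights f (P ++ y ∷ Q ++ y' ∷ R) ≡ m * (s + t' * f y' + t * f y)
  new-sum = begin
    weightedSum new-weights f (P ++ y ∷ Q ++ y' ∷ R)
      ≡⟨ weightedSum-shift₂ f bP P bQ Q bR R (m * t) (m * t') lenP lenQ ⟩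
    weightedSum (bP ++ b ∷ bQ ++ b' ∷ bR) f (P ++ y ∷ Q ++ y' ∷ R) + (m * t * f y + m * t' * f y')
      ≡⟨ cong (_+ (m * t * f y + m * t' * f y')) sum≡sm ⟩
    s * m + (m * t * f y + m * t' * f y')
      ≡⟨ identity s m t (f y) t' (f y') ⟩
    m * (s + t' * f y' + t * f y) ∎
    where
    open ≡-Reasoning
    identity : ∀ s m t a t' a' → s * m + (m * t * a + m * t' * a') ≡ m * (s + t' * a' + t * a)
    identity = solve-∀

AllPrimeFactors : (ℕ → Set) → HasΩ m j → Set
AllPrimeFactors P one             = ⊤
AllPrimeFactors P (prime {p} _ h) = P p × AllPrimeFactors P h

zeroSum-twoNondivisible : (h : HasΩ m j) → ¬ 2 ∣ m → {f : A → ℕ} {ys : List A} →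
  AllPrimeFactors (λ p → TwoNondivisible p f ys) h → ZeroSum m f ys
zeroSum-twoNondivisible one _ {f} {ys} tt = zeroSum-1 f ys
zeroSum-twoNondivisible (prime {p} {m} p-prime h) pm-odd (two , twos) =
  zeroSum-step p-prime (odd-prime∤2 p-prime (odd-∣ pm-odd (m∣m*n m))) two
    (zeroSum-twoNondivisible h (odd-∣ pm-odd (n∣m*n p)) twos)

HasΩ-divide : Prime p → p ∣ m → HasΩ m (suc j) → ∃[ m' ] m ≡ p * m' × HasΩ m' j
HasΩ-divide {p} p-prime p∣ (prime {q} {m} q-prime h) with euclidsLemma q m p-prime p∣
... | inj₁ p∣q with prime⇒irreducible q-prime p∣q
...   | inj₁ p≡1 = ⊥-elim (prime≢1 p-prime p≡1)
...   | inj₂ refl = m , refl , h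
HasΩ-divide p-prime _ (prime q-prime one) | inj₂ p∣1 = ⊥-elim (prime≢1 p-prime (∣1⇒≡1 p∣1))
HasΩ-divide {p} p-prime _ (prime {q} q-prime h@(prime _ _)) | inj₂ p∣m
  with HasΩ-divide p-prime p∣m h
... | m' , m≡pm' , h' = q * m' , trans (cong (q *_) m≡pm') (x∙yz≈y∙xz q p m') , prime q-prime h'

twoNondivisible-++ : {p : ℕ} {f : A → ℕ} {H₁ H₂ : List A} →
  Any (λ a → ¬ p ∣ f a) H₁ → Any (λ a → ¬ p ∣ f a) H₂ → TwoNondivisible p f (H₁ ++ H₂)
twoNondivisible-++ {p = p} {f} any₁ any₂ with find any₁ | find any₂
... | y , y∈H₁ , p∤fy | y' , y'∈H₂ , p∤fy' with ∈-∃++ y∈H₁ | ∈-∃++ y'∈H₂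
... | P , Q , refl | Q' , R , refl =
  subst (TwoNondivisible p f) reassociate (twoNondivisible P (Q ++ Q') R p∤fy p∤fy')
  where
  reassociate : P ++ y ∷ (Q ++ Q') ++ y' ∷ R ≡ (P ++ y ∷ Q) ++ Q' ++ y' ∷ R
  reassociate = trans (cong (λ zs → P ++ y ∷ zs) (++-assoc Q Q' (y' ∷ R)))
                      (sym (++-assoc P (y ∷ Q) (Q' ++ y' ∷ R)))

dividesAll⊎twoNondivisible : ∀ p (f : A → ℕ) H₁ H₂ →
  DividesAll p f H₁ ⊎ DividesAll p f H₂ ⊎ TwoNondivisible p f (H₁ ++ H₂)
dividesAll⊎twoNondivisible p f H₁ H₂
  with All.all? (λ a → p ∣? f a) H₁ | All.all? (λ a → p ∣? f a) H₂
... | yes p∣H₁ | _        = inj₁ p∣H₁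
... | no _     | yes p∣H₂ = inj₂ (inj₁ p∣H₂)
... | no p∤H₁  | no p∤H₂  = inj₂ (inj₂ (twoNondivisible-++
  (¬All⇒Any¬ (λ a → p ∣? f a) H₁ p∤H₁) (¬All⇒Any¬ (λ a → p ∣? f a) H₂ p∤H₂)))

dividesHalf⊎allTwoNondivisible : (h : HasΩ m j) (f : A → ℕ) (H₁ H₂ : List A) →
  (∃[ p ] Prime p × p ∣ m × (DividesAll p f H₁ ⊎ DividesAll p f H₂)) ⊎
  AllPrimeFactors (λ p → TwoNondivisible p f (H₁ ++ H₂)) h
dividesHalf⊎allTwoNondivisible one f H₁ H₂ = inj₂ tt
dividesHalf⊎allTwoNondivisible (prime {p} {m} p-prime h) f H₁ H₂
  with dividesAll⊎twoNondivisible p f H₁ H₂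
... | inj₁ p∣H₁        = inj₁ (p , p-prime , m∣m*n m , inj₁ p∣H₁)
... | inj₂ (inj₁ p∣H₂) = inj₁ (p , p-prime , m∣m*n m , inj₂ p∣H₂)
... | inj₂ (inj₂ two) with dividesHalf⊎allTwoNondivisible h f H₁ H₂
...   | inj₁ (q , q-prime , q∣m , q∣H) = inj₁ (q , q-prime , ∣n⇒∣m*n p q∣m , q∣H)
...   | inj₂ twos = inj₂ (two , twos)

consecutiveSub-trans : {R H S : List A} → ConsecutiveSub R H → ConsecutiveSub H S → ConsecutiveSub R S
consecutiveSub-trans {R = R} (nonempty , pre , post , refl) (_ , pre' , post' , refl) =
  nonempty , pre' ++ pre , post ++ post' , (begin
    pre' ++ ((pre ++ (R ++ post)) ++ post') ≡⟨ cong (pre' ++_) (++-assoc pre _ post') ⟩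
    pre' ++ (pre ++ ((R ++ post) ++ post')) ≡⟨ ++-assoc pre' pre _ ⟨
    (pre' ++ pre) ++ ((R ++ post) ++ post') ≡⟨ cong ((pre' ++ pre) ++_) (++-assoc R post post') ⟩
    (pre' ++ pre) ++ (R ++ (post ++ post')) ∎)
  where open ≡-Reasoning

All-consecutiveSub : {P : A → Set} {R H : List A} → All P H → ConsecutiveSub R H → All P R
All-consecutiveSub {R = R} all (_ , pre , _ , refl) = ++⁻ˡ R (++⁻ʳ pre all)

within : {P : List A → Set} {H xs : List A} → ConsecutiveSub H xs →
  ∃[ R ] ConsecutiveSub R H × P R → ∃[ R ] ConsecutiveSub R xs × P R
within H⊆xs (R , R⊆H , pR) = R , consecutiveSub-trans R⊆H H⊆xs , pR

prefix : ∀ a (xs : List A) → a ≤ length xs → ∃₂ λ H rest → xs ≡ H ++ rest × length H ≡ a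
prefix zero    xs       _         = [] , xs , refl , refl
prefix (suc a) (x ∷ xs) (s≤s a≤) with prefix a xs a≤
... | H , rest , refl , refl = x ∷ H , rest , refl , refl

splitLengths : ∀ a b (xs : List A) → a + b ≤ length xs →
  ∃₂ λ H₁ H₂ → ∃[ rest ] xs ≡ H₁ ++ H₂ ++ rest × length H₁ ≡ a × length H₂ ≡ b
splitLengths a b xs a+b≤ with prefix a xs (≤-trans (m≤m+n a b) a+b≤)
... | H₁ , xs₁ , refl , refl with prefix b xs₁ (+-cancelˡ-≤ a b _ (subst (a + b ≤_) (length-++ H₁) a+b≤))
... | H₂ , rest , refl , refl = H₁ , H₂ , rest , refl , refl , refl

divisibleBlock : ∀ k → HasΩ m (suc k) → ¬ 2 ∣ m → Prime p → p ∣ m → (f : A → ℕ) (H : List A) →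
  DividesAll p f H → 2 ^ k ≤ length H → ∃[ R ] ConsecutiveSub R H × ZeroSum m f R

zeroSumBlock : ∀ k → HasΩ m k → ¬ 2 ∣ m → (f : A → ℕ) (xs : List A) → 2 ^ k ≤ length xs →
  ∃[ R ] ConsecutiveSub R xs × ZeroSum m f R
zeroSumBlock zero one _ f (x ∷ xs) _ = x ∷ [] , (s≤s z≤n , [] , xs , refl) , zeroSum-1 f (x ∷ [])
zeroSumBlock (suc k) h m-odd f xs len
  with splitLengths (2 ^ k) (2 ^ k) xs (subst (_≤ length xs) (cong (2 ^ k +_) (+-identityʳ (2 ^ k))) len)
... | H₁ , H₂ , rest , refl , len₁ , len₂
  with dividesHalf⊎allTwoNondivisible h f H₁ H₂
... | inj₁ (p , p-prime , p∣m , inj₁ p∣H₁) =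
  within (subst (1 ≤_) (sym len₁) (m^n>0 2 k) , [] , H₂ ++ rest , refl)
    (divisibleBlock k h m-odd p-prime p∣m f H₁ p∣H₁ (≤-reflexive (sym len₁)))
... | inj₁ (p , p-prime , p∣m , inj₂ p∣H₂) =
  within (subst (1 ≤_) (sym len₂) (m^n>0 2 k) , H₁ , rest , refl)
    (divisibleBlock k h m-odd p-prime p∣m f H₂ p∣H₂ (≤-reflexive (sym len₂)))
... | inj₂ twos =
  H₁ ++ H₂ ,
  (≤-trans (subst (1 ≤_) (sym len₁) (m^n>0 2 k)) (length-++-≤ˡ H₁) , [] , rest , sym (++-assoc H₁ H₂ rest)) ,
  zeroSum-twoNondivisible h m-odd twos

divisibleBlock {p = p} k h m-odd p-prime p∣m f H p∣H len with HasΩ-divide p-prime p∣m h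
... | m' , refl , h' = divide {{prime⇒nonZero p-prime}}
  where
  divide : .{{NonZero p}} → ∃[ R ] ConsecutiveSub R H × ZeroSum (p * m') f R
  divide with zeroSumBlock k h' (odd-∣ m-odd (n∣m*n p)) (λ a → f a / p) H len
  ... | R , R⊆H , zs = R , R⊆H , zeroSum-/ p-prime (All-consecutiveSub p∣H R⊆H) zs

module _ {n : ℕ} .{{_ : NonZero n}} where

  %-shift : ∀ w → w ≡ w % n + n * (w / n)
  %-shift w = trans (m≡m%n+[m/n]*n w n) (cong (w % n +_) (*-comm (w / n) n))

  shifted-% : ∀ ws → Shifted n ws (map (_% n) ws)
  shifted-% []       = []
  shifted-% (w ∷ ws) = (w / n , %-shift w) ∷ shifted-% ws

  wsum-mod : ∀ ws R → wsum (map (_mod n) ws) R ≡ weightedSum (map (_% n) ws) toℕ R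
  wsum-mod []       R       = refl
  wsum-mod (w ∷ ws) []      = refl
  wsum-mod (w ∷ ws) (x ∷ R) = cong₂ _+_ (cong (_* toℕ x) (toℕ-fromℕ< (m%n<n w n))) (wsum-mod ws R)

  unit-mod : Coprime w n → IsUnit n (w mod n)
  unit-mod {w} w⊥n = subst (λ e → Coprime e n) (sym (toℕ-fromℕ< (m%n<n w n)))
    (coprime-unshift (w / n) (subst (λ e → Coprime e n) (%-shift w) w⊥n))

  toUnitWeightedZeroSum : {R : List (Fin n)} → 1 ≤ length R → ZeroSum n toℕ R → UnitWeightedZeroSum n R
  toUnitWeightedZeroSum {R} nonempty (weighting ws len units n∣) with weightedSum-shifted {n} (shifted-% ws) toℕ R
  ... | e , eq =
    nonempty , map (_mod n) ws , trans (length-map _ ws) len , map⁺ (All.map unit-mod units) ,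
    subst (n ∣_) (sym (wsum-mod ws R)) (∣+*⇒∣ e ∣-refl (subst (n ∣_) eq n∣))

mainTheorem15 : (n k : ℕ) → 1 < n → ¬ (2 ∣ n) → HasΩ n k →
    (S : List (Fin n)) (q : ℕ) → Prime q → q ∣ n →
    (T : List (Fin n)) → ConsecutiveSub T S →
    ((2 ^ k ∸ 1) + 1 ≤ 2 * length T) →
    All (DivBy q) T →
    Σ (List (Fin n)) λ R → ConsecutiveSub R S × UnitWeightedZeroSum n R
mainTheorem15 .1 zero (s≤s ()) _ one
mainTheorem15 n (suc k) 1<n n-odd h S q q-prime q∣n T T⊆S len q∣T
  with divisibleBlock k h n-odd q-prime q∣n toℕ T q∣T half-length
  where
  half-length : 2 ^ k ≤ length T
  half-length = *-cancelˡ-≤ 2 (subst (_≤ 2 * length T) (m∸n+n≡m (m^n>0 2 (suc k))) len)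
... | R , R⊆T , zs =
  R , consecutiveSub-trans R⊆T T⊆S ,
  toUnitWeightedZeroSum {{>-nonZero (<-trans (s≤s z≤n) 1<n)}} (proj₁ R⊆T) zs
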